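{- Let $C\subset\mathbb{R}^3$ be the cuboctahedron whose vertices are the midpoints of the twelve edges of the unit cube $[0,1]^3$, and for a positive integer $s$ let $i(s)=\#(sC\cap\mathbb{Z}^3)$. Then $$i(s)=\begin{cases}\frac{5s^3}{6}+2s^2+\frac{5s}{3}+1 & \text{if } s\equiv0\pmod 2,\\[2pt] \frac{5s^3}{6}+\frac{3s^2}{2}-\frac{5s}{6}-\frac{3}{2} & \text{if } s\equiv1\pmod 2.\end{cases}$$ -}

module Defs where

open import Data.Nat using (ℕ; zero; suc)
open import Data.Integer using (ℤ)
open import Data.Rational using (ℚ; 0ℚ; 1ℚ; ½; _+_; _*_; _≤_; _/_)
open import Data.Fin using (Fin; zero; suc)
open import Data.Product using (_×_; _,_; ∃-syntax)
open import Data.List using (List; length)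
open import Data.List.Relation.Unary.Unique.Propositional using (Unique)
open import Data.List.Membership.Propositional using (_∈_)
open import Relation.Binary.PropositionalEquality using (_≡_)
open import Function.Bundles using (_⇔_)
import Data.Integer as ℤ

Pt : Set
Pt = Fin 3 → ℚ

sumFin : (n : ℕ) → (Fin n → ℚ) → ℚ
sumFin zero    f = 0ℚ
sumFin (suc n) f = f zero + sumFin n (λ i → f (suc i))

pt : ℚ → ℚ → ℚ → Pt
pt x y z zero             = x
pt x y z (suc zero)       = y
pt x y z (suc (suc zero)) = z

vertex : Fin 12 → Pt
vertex zero = pt ½ 0ℚ 0ℚ
vertex (suc zero) = pt ½ 0ℚ 1ℚ
vertex (suc (suc zero)) = pt ½ 1ℚ 0ℚ
vertex (suc (suc (suc zero))) = pt ½ 1ℚ 1ℚ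
vertex (suc (suc (suc (suc zero)))) = pt 0ℚ ½ 0ℚ
vertex (suc (suc (suc (suc (suc zero))))) = pt 0ℚ ½ 1ℚ
vertex (suc (suc (suc (suc (suc (suc zero)))))) = pt 1ℚ ½ 0ℚ
vertex (suc (suc (suc (suc (suc (suc (suc zero))))))) = pt 1ℚ ½ 1ℚ
vertex (suc (suc (suc (suc (suc (suc (suc (suc zero)))))))) = pt 0ℚ 0ℚ ½
vertex (suc (suc (suc (suc (suc (suc (suc (suc (suc zero))))))))) = pt 0ℚ 1ℚ ½
vertex (suc (suc (suc (suc (suc (suc (suc (suc (suc (suc zero)))))))))) = pt 1ℚ 0ℚ ½
vertex (suc (suc (suc (suc (suc (suc (suc (suc (suc (suc (suc zero))))))))))) = pt 1ℚ 1ℚ ½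

Lattice : Set
Lattice = ℤ × ℤ × ℤ

toPt : Lattice → Pt
toPt (a , b , c) = pt (a / 1) (b / 1) (c / 1)

-- p ∈ s·C where C = conv(vertices): p is a convex combination of the
-- dilated vertices s·v_i.  (Rational coefficients suffice since all
-- vertices are rational.)
InDilate : ℕ → Pt → Set
InDilate s p =
  ∃[ λc ] ( (∀ i → 0ℚ ≤ λc i)
          × sumFin 12 λc ≡ 1ℚ
          × (∀ j → sumFin 12 (λ i → λc i * ((ℤ.+ s / 1) * vertex i j)) ≡ p j) )

LatticeCount : ℕ → ℕ → Set
LatticeCount s n =
  ∃[ L ] ( Unique L × length L ≡ n
         × (∀ (p : Lattice) → (p ∈ L) ⇔ InDilate s (toPt p)) )

-- Centring and doubling the coordinates, Q = 2p - s(1,1,1), turns sC into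
-- {Q : |Qⱼ| ≤ s, |Q₀| + |Q₁| + |Q₂| ≤ 2s}, the cube with its eight corner tetrahedra cut off.
-- A lattice point outside this set violates a facet inequality; these hold at the twelve
-- vertices and hence on sC.  A lattice point inside is written explicitly as a convex
-- combination of the vertices.  For the count, folding every coordinate by x ↦ min(x, s - x)
-- maps the cut-off lattice points eight-to-one onto {i + j + k < h}, h = ⌈s/2⌉, which has
-- h(h+1)(h+2)/6 points; so #(sC ∩ ℤ³) = (s+1)³ - 8h(h+1)(h+2)/6, and s = 2h or s = 2h - 1
-- gives the two formulas.
{-# OPTIONS --safe #-}
module Submission where

open import Defs
open import Algebra.Bundles using (Monoid)

module Counting where

  open import Function using (_∘_; _⇔_; mk⇔; Equivalence)
  import Function.Properties.Equivalence as ⇔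
  open import Data.Nat
  open import Data.Nat.Properties
  open import Data.Nat.Tactic.RingSolver using (solve-∀)
  open import Data.Nat.ListAction using (sum)
  open import Data.Nat.ListAction.Properties using (sum-++)
  open import Data.List using (List; []; _∷_; _++_; map; length; filter; applyUpTo; upTo; cartesianProduct)
  open import Data.List.Properties using (map-++; map-∘; map-applyUpTo; map-cong)
  open import Data.Product using (_×_; _,_)
  open import Relation.Nullary using (Dec; yes; no; ¬_; ¬?; contradiction)
  open import Relation.Unary using (Decidable)
  open import Relation.Binary.PropositionalEquality
  open ≡-Reasoning

  ∑< : ℕ → (ℕ → ℕ) → ℕ
  ∑< n f = sum (applyUpTo f n)

  ∑<-cong : ∀ n {f g : ℕ → ℕ} → (∀ x → x < n → f x ≡ g x) → ∑< n f ≡ ∑< n g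
  ∑<-cong zero    f≡g = refl
  ∑<-cong (suc n) f≡g = cong₂ _+_ (f≡g 0 z<s) (∑<-cong n λ x x<n → f≡g (suc x) (s<s x<n))

  ∑<-+ : ∀ n (f g : ℕ → ℕ) → ∑< n (λ x → f x + g x) ≡ ∑< n f + ∑< n g
  ∑<-+ zero    f g = refl
  ∑<-+ (suc n) f g = trans (cong (f 0 + g 0 +_) (∑<-+ n (f ∘ suc) (g ∘ suc)))
                           (+-+-comm (f 0) (g 0) (∑< n (f ∘ suc)) (∑< n (g ∘ suc)))
    where +-+-comm : ∀ a b c d → a + b + (c + d) ≡ a + c + (b + d)
          +-+-comm = solve-∀

  ∑<-*ˡ : ∀ n c (f : ℕ → ℕ) → ∑< n (λ x → c * f x) ≡ c * ∑< n f
  ∑<-*ˡ zero    c f = sym (*-zeroʳ c)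
  ∑<-*ˡ (suc n) c f = trans (cong (c * f 0 +_) (∑<-*ˡ n c (f ∘ suc))) (sym (*-distribˡ-+ c (f 0) _))

  ∑<-const : ∀ n c → ∑< n (λ _ → c) ≡ n * c
  ∑<-const zero    c = refl
  ∑<-const (suc n) c = cong (c +_) (∑<-const n c)

  ∑<-zero : ∀ n {f : ℕ → ℕ} → (∀ x → f x ≡ 0) → ∑< n f ≡ 0
  ∑<-zero n f≡0 = trans (∑<-cong n λ x _ → f≡0 x) (trans (∑<-const n 0) (*-zeroʳ n))

  ∑<-snoc : ∀ n (f : ℕ → ℕ) → ∑< (suc n) f ≡ ∑< n f + f n
  ∑<-snoc zero    f = +-comm (f 0) 0
  ∑<-snoc (suc n) f = trans (cong (f 0 +_) (∑<-snoc n (f ∘ suc))) (sym (+-assoc (f 0) _ _))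

  ∑³< : ℕ → (ℕ → ℕ → ℕ → ℕ) → ℕ
  ∑³< n f = ∑< n λ x → ∑< n λ y → ∑< n λ z → f x y z

  ∑³<-cong : ∀ n {f g : ℕ → ℕ → ℕ → ℕ} → (∀ x y z → f x y z ≡ g x y z) → ∑³< n f ≡ ∑³< n g
  ∑³<-cong n f≡g = ∑<-cong n λ x _ → ∑<-cong n λ y _ → ∑<-cong n λ z _ → f≡g x y z

  ∑³<-+ : ∀ n (f g : ℕ → ℕ → ℕ → ℕ) → ∑³< n (λ x y z → f x y z + g x y z) ≡ ∑³< n f + ∑³< n g
  ∑³<-+ n f g = trans (∑<-cong n λ x _ → trans (∑<-cong n λ y _ → ∑<-+ n (f x y) (g x y)) (∑<-+ n _ _))
                      (∑<-+ n _ _)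

  ∑³<-const : ∀ n c → ∑³< n (λ _ _ _ → c) ≡ n * (n * (n * c))
  ∑³<-const n c = trans (∑<-cong n λ _ _ → trans (∑<-cong n λ _ _ → ∑<-const n c) (∑<-const n (n * c)))
                        (∑<-const n (n * (n * c)))

  iverson : ∀ {P : Set} → Dec P → ℕ
  iverson (yes _) = 1
  iverson (no  _) = 0

  iverson-yes : ∀ {P : Set} (P? : Dec P) → P → iverson P? ≡ 1
  iverson-yes (yes _) _ = refl
  iverson-yes (no ¬p) p = contradiction p ¬p

  iverson-no : ∀ {P : Set} (P? : Dec P) → ¬ P → iverson P? ≡ 0
  iverson-no (yes p) ¬p = contradiction p ¬p
  iverson-no (no _)  _  = refl

  iverson-cong : ∀ {P Q : Set} (P? : Dec P) (Q? : Dec Q) → P ⇔ Q → iverson P? ≡ iverson Q?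
  iverson-cong (yes p) Q? P⇔Q = sym (iverson-yes Q? (Equivalence.to P⇔Q p))
  iverson-cong (no ¬p) Q? P⇔Q = sym (iverson-no Q? (¬p ∘ Equivalence.from P⇔Q))

  iverson-¬ : ∀ {P : Set} (P? : Dec P) (¬P? : Dec (¬ P)) → iverson P? + iverson ¬P? ≡ 1
  iverson-¬ (yes p) ¬P? = cong suc (iverson-no ¬P? λ ¬p → ¬p p)
  iverson-¬ (no ¬p) ¬P? = iverson-yes ¬P? ¬p

  length-filter : ∀ {A : Set} {P : A → Set} (P? : Decidable P) (xs : List A) →
                  length (filter P? xs) ≡ sum (map (iverson ∘ P?) xs)
  length-filter P? []       = refl
  length-filter P? (x ∷ xs) with P? x
  ... | yes _ = cong suc (length-filter P? xs)
  ... | no  _ = length-filter P? xs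

  sum-cartesianProduct : ∀ {A B : Set} (f : A × B → ℕ) xs ys →
    sum (map f (cartesianProduct xs ys)) ≡ sum (map (λ x → sum (map (λ y → f (x , y)) ys)) xs)
  sum-cartesianProduct f []       ys = refl
  sum-cartesianProduct f (x ∷ xs) ys = begin
    sum (map f (map (x ,_) ys ++ cartesianProduct xs ys))
      ≡⟨ cong sum (map-++ f (map (x ,_) ys) (cartesianProduct xs ys)) ⟩
    sum (map f (map (x ,_) ys) ++ map f (cartesianProduct xs ys))
      ≡⟨ sum-++ (map f (map (x ,_) ys)) _ ⟩
    sum (map f (map (x ,_) ys)) + sum (map f (cartesianProduct xs ys))
      ≡⟨ cong₂ _+_ (cong sum (sym (map-∘ ys))) (sum-cartesianProduct f xs ys) ⟩
    sum (map (λ y → f (x , y)) ys) + sum (map (λ x → sum (map (λ y → f (x , y)) ys)) xs) ∎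

  sum-upTo : ∀ n (f : ℕ → ℕ) → sum (map f (upTo n)) ≡ ∑< n f
  sum-upTo n f = cong sum (map-applyUpTo (λ x → x) f n)

  cube : ℕ → List (ℕ × ℕ × ℕ)
  cube n = cartesianProduct (upTo n) (cartesianProduct (upTo n) (upTo n))

  count-cube : ∀ {P : ℕ × ℕ × ℕ → Set} (P? : Decidable P) n →
               length (filter P? (cube n)) ≡ ∑³< n (λ x y z → iverson (P? (x , y , z)))
  count-cube P? n = begin
    length (filter P? (cube n))
      ≡⟨ length-filter P? (cube n) ⟩
    sum (map (iverson ∘ P?) (cube n))
      ≡⟨ sum-cartesianProduct (iverson ∘ P?) (upTo n) _ ⟩
    sum (map (λ x → sum (map (λ yz → iverson (P? (x , yz))) (cartesianProduct (upTo n) (upTo n)))) (upTo n))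
      ≡⟨ cong sum (map-cong plane (upTo n)) ⟩
    sum (map (λ x → ∑< n λ y → ∑< n λ z → iverson (P? (x , y , z))) (upTo n))
      ≡⟨ sum-upTo n _ ⟩
    ∑³< n (λ x y z → iverson (P? (x , y , z))) ∎
    where
    plane : ∀ x → sum (map (λ yz → iverson (P? (x , yz))) (cartesianProduct (upTo n) (upTo n)))
                ≡ ∑< n λ y → ∑< n λ z → iverson (P? (x , y , z))
    plane x = trans (sum-cartesianProduct _ (upTo n) (upTo n))
                    (trans (cong sum (map-cong (λ y → sum-upTo n _) (upTo n))) (sum-upTo n _))

  fold : ℕ → ℕ → ℕ
  fold s x = x ⊓ (s ∸ x)

  fold-suc : ∀ {s x} → x ≤ s → fold (2 + s) (suc x) ≡ suc (fold s x)
  fold-suc {s} {x} x≤s = cong (suc x ⊓_) (+-∸-assoc 1 x≤s)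

  fold-self : ∀ s → fold s s ≡ 0
  fold-self s = trans (cong (s ⊓_) (n∸n≡0 s)) (⊓-zeroʳ s)

  ∑<-fold : ∀ s (g : ℕ → ℕ) → (∀ k → s ≤ 2 * k → g k ≡ 0) →
            ∑< (suc s) (g ∘ fold s) ≡ 2 * ∑< ⌈ s /2⌉ g
  ∑<-fold zero          g g≡0 = trans (+-identityʳ (g 0)) (g≡0 0 z≤n)
  ∑<-fold (suc zero)    g g≡0 = double (g 0)
    where double : ∀ a → a + (a + 0) ≡ 2 * (a + 0)
          double = solve-∀
  ∑<-fold (suc (suc s)) g g≡0 = begin
    g 0 + ∑< (2 + s) (λ x → g (fold (2 + s) (suc x)))
      ≡⟨ cong (g 0 +_) (∑<-snoc (suc s) λ x → g (fold (2 + s) (suc x))) ⟩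
    g 0 + (∑< (suc s) (λ x → g (fold (2 + s) (suc x))) + g (fold (2 + s) (2 + s)))
      ≡⟨ cong₂ (λ m k → g 0 + (m + g k)) (∑<-cong (suc s) λ x x≤s → cong g (fold-suc (s≤s⁻¹ x≤s)))
                                         (fold-self (2 + s)) ⟩
    g 0 + (∑< (suc s) (g ∘ suc ∘ fold s) + g 0)
      ≡⟨ cong (λ m → g 0 + (m + g 0)) (∑<-fold s (g ∘ suc) λ k s≤2k → g≡0 (suc k) (2+s≤2[1+k] s≤2k)) ⟩
    g 0 + (2 * ∑< ⌈ s /2⌉ (g ∘ suc) + g 0)
      ≡⟨ regroup (g 0) _ ⟩
    2 * ∑< ⌈ 2 + s /2⌉ g ∎
    where
    regroup : ∀ a b → a + (2 * b + a) ≡ 2 * (a + b)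
    regroup = solve-∀
    2+s≤2[1+k] : ∀ {k} → s ≤ 2 * k → 2 + s ≤ 2 * suc k
    2+s≤2[1+k] {k} s≤2k = subst (2 + s ≤_) (sym (*-suc 2 k)) (s≤s (s≤s s≤2k))

  ∑³<-fold : ∀ s (g : ℕ → ℕ → ℕ → ℕ) → (∀ i j k → s ≤ 2 * (i + j + k) → g i j k ≡ 0) →
             ∑³< (suc s) (λ x y z → g (fold s x) (fold s y) (fold s z)) ≡ 8 * ∑³< ⌈ s /2⌉ g
  ∑³<-fold s g g≡0 = begin
    ∑< (suc s) (λ x → ∑< (suc s) λ y → ∑< (suc s) λ z → g (fold s x) (fold s y) (fold s z))
      ≡⟨ ∑<-fold s _ (λ i s≤2i → ∑<-zero (suc s) λ y → ∑<-zero (suc s) λ z →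
           g≡0 i (fold s y) (fold s z) (widen s≤2i (m≤m+n i (fold s y)) (m≤m+n (i + fold s y) (fold s z)))) ⟩
    2 * ∑< h (λ i → ∑< (suc s) λ y → ∑< (suc s) λ z → g i (fold s y) (fold s z))
      ≡⟨ cong (2 *_) (∑<-cong h λ i _ → ∑<-fold s _ λ j s≤2j → ∑<-zero (suc s) λ z →
           g≡0 i j (fold s z) (widen s≤2j (m≤n+m j i) (m≤m+n (i + j) (fold s z)))) ⟩
    2 * ∑< h (λ i → 2 * ∑< h λ j → ∑< (suc s) λ z → g i j (fold s z))
      ≡⟨ cong (2 *_) (∑<-cong h λ i _ → cong (2 *_) (∑<-cong h λ j _ → ∑<-fold s (g i j) λ k s≤2k →
           g≡0 i j k (widen s≤2k (m≤n+m k (i + j)) ≤-refl))) ⟩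
    2 * ∑< h (λ i → 2 * ∑< h λ j → 2 * ∑< h λ k → g i j k)
      ≡⟨ cong (2 *_) (trans (∑<-*ˡ h 2 _) (cong (2 *_) (trans (∑<-cong h λ i _ → ∑<-*ˡ h 2 _) (∑<-*ˡ h 2 _)))) ⟩
    2 * (2 * (2 * ∑³< h g))
      ≡⟨ eight (∑³< h g) ⟩
    8 * ∑³< h g ∎
    where
    h = ⌈ s /2⌉
    widen : ∀ {a b c} → s ≤ 2 * a → a ≤ b → b ≤ c → s ≤ 2 * c
    widen s≤2a a≤b b≤c = ≤-trans s≤2a (*-monoʳ-≤ 2 (≤-trans a≤b b≤c))
    eight : ∀ a → 2 * (2 * (2 * a)) ≡ 8 * a
    eight = solve-∀

  ∑<-below : ∀ n t → t ≤ n → ∑< n (λ k → iverson (k <? t)) ≡ t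
  ∑<-below zero    zero    _         = refl
  ∑<-below (suc n) zero    _         = ∑<-zero (suc n) λ k → iverson-no (k <? 0) λ ()
  ∑<-below (suc n) (suc t) (s≤s t≤n) =
    cong suc (trans (∑<-cong n λ k _ → iverson-cong (suc k <? suc t) (k <? t) (mk⇔ s<s⁻¹ s<s))
                    (∑<-below n t t≤n))

  <∸⇔+< : ∀ {c k h} → k < h ∸ c ⇔ c + k < h
  <∸⇔+< {c} {k} {h} = mk⇔ to from
    where
    to : k < h ∸ c → c + k < h
    to k<h∸c = subst (_≤ h) (+-suc c k) (subst (c + suc k ≤_) (m+[n∸m]≡n c≤h) (+-monoʳ-≤ c k<h∸c))
      where c≤h : c ≤ h
            c≤h = <⇒≤ (m∸n≢0⇒n<m λ h∸c≡0 → n≮0 (subst (k <_) h∸c≡0 k<h∸c))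
    from : c + k < h → k < h ∸ c
    from c+k<h = m+n≤o⇒m≤o∸n (suc k) (subst (_≤ h) (cong suc (+-comm c k)) c+k<h)

  tetrahedral : ℕ → ℕ
  tetrahedral h = ∑³< h (λ i j k → iverson (i + j + k <? h))

  6*tetrahedral : ∀ h → 6 * tetrahedral h ≡ h * suc h * suc (suc h)
  6*tetrahedral h = begin
    6 * tetrahedral h
      ≡⟨ 6≡3*2 (tetrahedral h) ⟩
    3 * (2 * tetrahedral h)
      ≡⟨ cong (3 *_) (∑<-*ˡ h 2 _) ⟨
    3 * ∑< h (λ i → 2 * ∑< h λ j → ∑< h λ k → iverson (i + j + k <? h))
      ≡⟨ cong (3 *_) (∑<-cong h λ i _ → cong (2 *_) (∑<-cong h λ j _ → row (i + j))) ⟩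
    3 * ∑< h (λ i → 2 * ∑< h λ j → h ∸ (i + j))
      ≡⟨ cong (3 *_) (∑<-cong h λ i _ → trans (cong (2 *_) (∑<-cong h λ j _ → sym (∸-+-assoc h i j)))
                                               (triangle h (h ∸ i) (m∸n≤m h i))) ⟩
    3 * ∑< h (λ i → (h ∸ i) * suc (h ∸ i))
      ≡⟨ pyramid h ⟩
    h * suc h * suc (suc h) ∎
    where
    6≡3*2 : ∀ a → 6 * a ≡ 3 * (2 * a)
    6≡3*2 = solve-∀
    row : ∀ c → ∑< h (λ k → iverson (c + k <? h)) ≡ h ∸ c
    row c = trans (∑<-cong h λ k _ → iverson-cong (c + k <? h) (k <? h ∸ c) (⇔.sym <∸⇔+<))
                  (∑<-below h (h ∸ c) (m∸n≤m h c))
    triangle : ∀ n m → m ≤ n → 2 * ∑< n (λ j → m ∸ j) ≡ m * suc m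
    triangle zero    zero    _         = refl
    triangle (suc n) zero    _         = cong (2 *_) (∑<-zero (suc n) 0∸n≡0)
    triangle (suc n) (suc m) (s≤s m≤n) = begin
      2 * (suc m + ∑< n (λ j → m ∸ j))      ≡⟨ *-distribˡ-+ 2 (suc m) _ ⟩
      2 * suc m + 2 * ∑< n (λ j → m ∸ j)    ≡⟨ cong (2 * suc m +_) (triangle n m m≤n) ⟩
      2 * suc m + m * suc m                 ≡⟨ step m ⟩
      suc m * suc (suc m)                   ∎
      where step : ∀ m → 2 * suc m + m * suc m ≡ suc m * suc (suc m)
            step = solve-∀
    pyramid : ∀ h → 3 * ∑< h (λ i → (h ∸ i) * suc (h ∸ i)) ≡ h * suc h * suc (suc h)
    pyramid zero    = refl
    pyramid (suc h) = begin
      3 * (suc h * suc (suc h) + ∑< h (λ i → (h ∸ i) * suc (h ∸ i)))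
        ≡⟨ *-distribˡ-+ 3 (suc h * suc (suc h)) _ ⟩
      3 * (suc h * suc (suc h)) + 3 * ∑< h (λ i → (h ∸ i) * suc (h ∸ i))
        ≡⟨ cong (3 * (suc h * suc (suc h)) +_) (pyramid h) ⟩
      3 * (suc h * suc (suc h)) + h * suc h * suc (suc h)
        ≡⟨ step h ⟩
      suc h * suc (suc h) * suc (suc (suc h)) ∎
      where step : ∀ h → 3 * (suc h * suc (suc h)) + h * suc h * suc (suc h)
                         ≡ suc h * suc (suc h) * suc (suc (suc h))
            step = solve-∀

  2*m<s⇔m<⌈s/2⌉ : ∀ {m s} → 2 * m < s ⇔ m < ⌈ s /2⌉
  2*m<s⇔m<⌈s/2⌉ {m} {s} = mk⇔ (to m s) (from m s)
    where
    to : ∀ m s → 2 * m < s → m < ⌈ s /2⌉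
    to zero    (suc zero)    _  = z<s
    to zero    (suc (suc s)) _  = z<s
    to (suc m) (suc (suc s)) lt = s<s (to m s (s<s⁻¹ (s<s⁻¹ (subst (_< suc (suc s)) (*-suc 2 m) lt))))
    to (suc m) (suc zero)    (s≤s ())
    from : ∀ m s → m < ⌈ s /2⌉ → 2 * m < s
    from zero    (suc s)       _  = z<s
    from (suc m) (suc (suc s)) lt = subst (_< suc (suc s)) (sym (*-suc 2 m)) (s<s (s<s (from m s (s<s⁻¹ lt))))
    from (suc m) (suc zero)    (s≤s ())

  -- The ℓ¹-distance from the point to the nearest corner of [0,s]³ is at least s/2.
  Uncut : ℕ → ℕ × ℕ × ℕ → Set
  Uncut s (x , y , z) = s ≤ 2 * (fold s x + fold s y + fold s z)

  uncut? : ∀ s → Decidable (Uncut s)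
  uncut? s (x , y , z) = s ≤? 2 * (fold s x + fold s y + fold s z)

  uncut-count : ℕ → ℕ
  uncut-count s = ∑³< (suc s) (λ x y z → iverson (uncut? s (x , y , z)))

  uncut+corners≡cube : ∀ s → uncut-count s + 8 * tetrahedral ⌈ s /2⌉ ≡ suc s * (suc s * (suc s * 1))
  uncut+corners≡cube s = begin
    uncut-count s + 8 * tetrahedral h
      ≡⟨ cong (λ t → uncut-count s + 8 * t) (∑³<-cong h λ i j k →
           iverson-cong (i + j + k <? h) (cut? (i + j + k))
             (mk⇔ (<⇒≱ ∘ Equivalence.from 2*m<s⇔m<⌈s/2⌉) (Equivalence.to 2*m<s⇔m<⌈s/2⌉ ∘ ≰⇒>))) ⟩
    uncut-count s + 8 * ∑³< h (λ i j k → iverson (cut? (i + j + k)))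
      ≡⟨ cong (uncut-count s +_) (∑³<-fold s (λ i j k → iverson (cut? (i + j + k)))
                                   λ i j k s≤ → iverson-no (cut? (i + j + k)) λ ¬s≤ → ¬s≤ s≤) ⟨
    uncut-count s + ∑³< (suc s) (λ x y z → iverson (cut? (fold s x + fold s y + fold s z)))
      ≡⟨ ∑³<-+ (suc s) (λ x y z → iverson (uncut? s (x , y , z)))
                       (λ x y z → iverson (cut? (fold s x + fold s y + fold s z))) ⟨
    ∑³< (suc s) (λ x y z → iverson (uncut? s (x , y , z)) + iverson (cut? (fold s x + fold s y + fold s z)))
      ≡⟨ ∑³<-cong (suc s) (λ x y z → iverson-¬ (uncut? s (x , y , z)) (cut? (fold s x + fold s y + fold s z))) ⟩
    ∑³< (suc s) (λ _ _ _ → 1)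
      ≡⟨ ∑³<-const (suc s) 1 ⟩
    suc s * (suc s * (suc s * 1)) ∎
    where
    h = ⌈ s /2⌉
    cut? : ∀ m → Dec (¬ s ≤ 2 * m)
    cut? m = ¬? (s ≤? 2 * m)

module CornerWeights where

  open import Function using (_∘_)
  open import Data.Bool using (if_then_else_)
  open import Data.Nat as ℕ using (ℕ; suc)
  import Data.Nat.Properties as ℕ
  open import Data.Fin using (Fin; zero; suc; punchIn)
  open import Data.Fin.Patterns using (0F; 1F; 2F)
  import Data.Fin.Properties as Fin
  open import Data.Integer using (ℤ; +_; +[1+_]; 0ℤ; 1ℤ; -1ℤ; -_; _+_; _*_; _-_; _⊔_; _≤_; _<_; _≤?_;
                                  +≤+; +<+; nonNegative)
  open import Data.Integer.Properties
  open import Data.Integer.Tactic.RingSolver using (solve-∀)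
  open import Algebra.Properties.Semiring.Sum +-*-semiring using (sum; sum-cong-≗; sum-replicate-zero)
  open import Data.Product using (_×_; _,_)
  open import Relation.Nullary using (does; yes; no)
  open import Relation.Binary.PropositionalEquality
  open ≡-Reasoning

  *-nonNeg : ∀ {i j} → 0ℤ ≤ i → 0ℤ ≤ j → 0ℤ ≤ i * j
  *-nonNeg {j = j} 0≤i 0≤j = *-monoʳ-≤-nonNeg j {{nonNegative 0≤j}} 0≤i

  *-pos : ∀ {i j} → 0ℤ < i → 0ℤ < j → 0ℤ < i * j
  *-pos {+[1+ m ]} {+[1+ n ]} _        _        = +<+ (ℕ.s≤s ℕ.z≤n)
  *-pos {+ 0}                 (+<+ ()) _
  *-pos {+[1+ m ]} {+ 0}      _        (+<+ ())

  sgn : Fin 2 → ℤ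
  sgn 0F = -1ℤ
  sgn 1F = 1ℤ

  sgn*-bounded : ∀ σ {d y} → 0ℤ ≤ y → y ≤ d → - d ≤ sgn σ * y × sgn σ * y ≤ d
  sgn*-bounded 0F {d} {y} 0≤y y≤d rewrite -1*i≡-i y = neg-mono-≤ y≤d , ≤-trans (neg-mono-≤ 0≤y) (≤-trans 0≤y y≤d)
  sgn*-bounded 1F {d} {y} 0≤y y≤d rewrite *-identityˡ y = ≤-trans (neg-mono-≤ (≤-trans 0≤y y≤d)) 0≤y , y≤d

  0≤d+sgn*x : ∀ a {d x} → - d ≤ x → x ≤ d → 0ℤ ≤ d + sgn a * x
  0≤d+sgn*x 0F {d} {x} _ x≤d = subst (0ℤ ≤_) (identity d x) (i≤j⇒0≤j-i x≤d)
    where identity : ∀ d x → d - x ≡ d + -1ℤ * x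
          identity = solve-∀
  0≤d+sgn*x 1F {d} {x} -d≤x _ = subst (0ℤ ≤_) (identity d x) (i≤j⇒0≤j-i -d≤x)
    where identity : ∀ d x → x - - d ≡ d + 1ℤ * x
          identity = solve-∀

  δ : ∀ {n} → Fin n → Fin n → ℤ
  δ i j = if does (i Fin.≟ j) then 1ℤ else 0ℤ

  ∑-δ : ∀ {n} (i : Fin n) (f : Fin n → ℤ) → sum (λ j → δ i j * f j) ≡ f i
  ∑-δ {suc n} zero    f = trans (cong₂ _+_ (*-identityˡ (f zero)) (sum-replicate-zero n)) (+-identityʳ (f zero))
  ∑-δ {suc n} (suc i) f = trans (+-identityˡ _) (∑-δ i (f ∘ suc))

  -- The vertices of the centred and doubled cuboctahedron 2C - (1,1,1).
  corner : Fin 3 → Fin 2 → Fin 2 → Fin 3 → ℤ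
  corner k a b j = δ (punchIn k 0F) j * sgn a + δ (punchIn k 1F) j * sgn b

  ∑³ : (Fin 3 → Fin 2 → Fin 2 → ℤ) → ℤ
  ∑³ w = sum λ k → sum λ a → sum λ b → w k a b

  module BilinearInterpolation (α d x d′ x′ : ℤ) where

    total : sum (λ a → sum λ b → α * ((d + sgn a * x) * (d′ + sgn b * x′))) ≡ α * (+ 4 * d * d′)
    total = identity α d x d′ x′
      where
      identity : ∀ α d x d′ x′ →
        α * ((d + -1ℤ * x) * (d′ + -1ℤ * x′)) + (α * ((d + -1ℤ * x) * (d′ + 1ℤ * x′)) + 0ℤ)
        + (α * ((d + 1ℤ * x) * (d′ + -1ℤ * x′)) + (α * ((d + 1ℤ * x) * (d′ + 1ℤ * x′)) + 0ℤ) + 0ℤ)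
        ≡ α * (+ 4 * d * d′)
      identity = solve-∀

    moment : ∀ p q → sum (λ a → sum λ b → α * ((d + sgn a * x) * (d′ + sgn b * x′)) * (p * sgn a + q * sgn b))
                     ≡ α * (p * (+ 4 * x * d′) + q * (+ 4 * d * x′))
    moment = identity α d x d′ x′
      where
      identity : ∀ α d x d′ x′ p q →
        α * ((d + -1ℤ * x) * (d′ + -1ℤ * x′)) * (p * -1ℤ + q * -1ℤ)
          + (α * ((d + -1ℤ * x) * (d′ + 1ℤ * x′)) * (p * -1ℤ + q * 1ℤ) + 0ℤ)
        + (α * ((d + 1ℤ * x) * (d′ + -1ℤ * x′)) * (p * 1ℤ + q * -1ℤ)
          + (α * ((d + 1ℤ * x) * (d′ + 1ℤ * x′)) * (p * 1ℤ + q * 1ℤ) + 0ℤ) + 0ℤ)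
        ≡ α * (p * (+ 4 * x * d′) + q * (+ 4 * d * x′))
      identity = solve-∀

  record CornerCombination (s : ℕ) (Q : Fin 3 → ℤ) : Set where
    field
      weight        : Fin 3 → Fin 2 → Fin 2 → ℤ
      weight-nonneg : ∀ k a b → 0ℤ ≤ weight k a b
      total-pos     : 0ℤ < ∑³ weight
      barycentre    : ∀ j → + s * ∑³ (λ k a b → weight k a b * corner k a b j) ≡ ∑³ weight * Q j

  -- Write e j for the distance of the j-th coordinate to the nearer end of [0, s], E for their sum
  -- and D j = E - e j.  Then Q / s is the average, with weights e k / E, of the points r⁽ᵏ⁾ with
  -- r⁽ᵏ⁾ k = 0 and r⁽ᵏ⁾ j = E * Q j / (s * D j); r⁽ᵏ⁾ lies on the square face k and is the bilinear
  -- interpolation of its four corners.  Clearing denominators gives `weight`; using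
  -- d j = s * (D j ⊔ 1) instead of s * D j avoids dividing by zero, as D j = 0 forces Q j = 0.
  module CuboctahedronWeights
    (s : ℕ) (e : Fin 3 → ℕ) (σ : Fin 3 → Fin 2)
    (1≤s : 1 ℕ.≤ s) (2e≤s : ∀ j → 2 ℕ.* e j ℕ.≤ s) (s≤2E : s ℕ.≤ 2 ℕ.* (e 0F ℕ.+ e 1F ℕ.+ e 2F))
    where

    E : ℤ
    E = + e 0F + + e 1F + + e 2F

    D : Fin 3 → ℤ
    D j = + e (punchIn j 0F) + + e (punchIn j 1F)

    A : Fin 3 → ℤ
    A j = + s - + 2 * + e j

    Q : Fin 3 → ℤ
    Q j = sgn (σ j) * A j

    d : Fin 3 → ℤ
    d j = + s * (D j ⊔ 1ℤ)

    x : Fin 3 → ℤ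
    x j = sgn (σ j) * (E * A j)

    P : Fin 3 → ℤ
    P j = d (punchIn j 0F) * d (punchIn j 1F)

    weight : Fin 3 → Fin 2 → Fin 2 → ℤ
    weight k a b = + e k * d k * ((d l + sgn a * x l) * (d m + sgn b * x m))
      where l = punchIn k 0F
            m = punchIn k 1F

    E≡e+D : ∀ j → E ≡ + e j + D j
    E≡e+D 0F = +-assoc (+ e 0F) (+ e 1F) (+ e 2F)
    E≡e+D 1F = identity (+ e 0F) (+ e 1F) (+ e 2F)
      where identity : ∀ a b c → a + b + c ≡ b + (a + c)
            identity = solve-∀
    E≡e+D 2F = identity (+ e 0F) (+ e 1F) (+ e 2F)
      where identity : ∀ a b c → a + b + c ≡ c + (a + b)
            identity = solve-∀

    d*P≡∏d : ∀ j → d j * P j ≡ d 0F * d 1F * d 2F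
    d*P≡∏d 0F = sym (*-assoc (d 0F) (d 1F) (d 2F))
    d*P≡∏d 1F = identity (d 0F) (d 1F) (d 2F)
      where identity : ∀ a b c → b * (a * c) ≡ a * b * c
            identity = solve-∀
    d*P≡∏d 2F = identity (d 0F) (d 1F) (d 2F)
      where identity : ∀ a b c → c * (a * b) ≡ a * b * c
            identity = solve-∀

    E≡+ : E ≡ + (e 0F ℕ.+ e 1F ℕ.+ e 2F)
    E≡+ = sym (trans (pos-+ (e 0F ℕ.+ e 1F) (e 2F)) (cong (_+ + e 2F) (pos-+ (e 0F) (e 1F))))

    0<E : 0ℤ < E
    0<E = subst (0ℤ <_) (sym E≡+) (+<+ (ℕ.n≢0⇒n>0 λ E≡0 →
            ℕ.<⇒≱ 1≤s (ℕ.≤-trans s≤2E (ℕ.≤-reflexive (cong (2 ℕ.*_) E≡0)))))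

    s≤2*E : + s ≤ + 2 * E
    s≤2*E = subst (+ s ≤_) (trans (pos-* 2 (e 0F ℕ.+ e 1F ℕ.+ e 2F)) (cong (+ 2 *_) (sym E≡+))) (+≤+ s≤2E)

    0≤E*A : ∀ j → 0ℤ ≤ E * A j
    0≤E*A j = *-nonNeg (<⇒≤ 0<E) (i≤j⇒0≤j-i (subst (_≤ + s) (pos-* 2 (e j)) (+≤+ (2e≤s j))))

    E*A≤s*D : ∀ j → E * A j ≤ + s * D j
    E*A≤s*D j = 0≤i-j⇒j≤i (subst (0ℤ ≤_) (sym gap) (*-nonNeg {+ e j} (+≤+ ℕ.z≤n) (i≤j⇒0≤j-i s≤2*E)))
      where
      identity : ∀ S e D → S * D - (e + D) * (S - + 2 * e) ≡ e * (+ 2 * (e + D) - S)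
      identity = solve-∀
      gap : + s * D j - E * A j ≡ + e j * (+ 2 * E - + s)
      gap = begin
        + s * D j - E * A j                    ≡⟨ cong (λ F → + s * D j - F * A j) (E≡e+D j) ⟩
        + s * D j - (+ e j + D j) * A j        ≡⟨ identity (+ s) (+ e j) (D j) ⟩
        + e j * (+ 2 * (+ e j + D j) - + s)    ≡⟨ cong (λ F → + e j * (+ 2 * F - + s)) (E≡e+D j) ⟨
        + e j * (+ 2 * E - + s)                ∎

    s*D≤d : ∀ j → + s * D j ≤ d j
    s*D≤d j = *-monoˡ-≤-nonNeg (+ s) (i≤i⊔j (D j) 1ℤ)

    0<d : ∀ j → 0ℤ < d j
    0<d j = *-pos (+<+ 1≤s) (<-≤-trans (+<+ (ℕ.s≤s ℕ.z≤n)) (i≤j⊔i (D j) 1ℤ))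

    weight-nonneg : ∀ k a b → 0ℤ ≤ weight k a b
    weight-nonneg k a b = *-nonNeg (*-nonNeg {+ e k} (+≤+ ℕ.z≤n) (<⇒≤ (0<d k)))
                                   (*-nonNeg (factor (punchIn k 0F) a) (factor (punchIn k 1F) b))
      where
      factor : ∀ j a → 0ℤ ≤ d j + sgn a * x j
      factor j a = let -d≤x , x≤d = sgn*-bounded (σ j) (0≤E*A j) (≤-trans (E*A≤s*D j) (s*D≤d j))
                   in 0≤d+sgn*x a -d≤x x≤d

    x*s*D≡x*d : ∀ j → x j * (+ s * D j) ≡ x j * d j
    x*s*D≡x*d j with D j ≤? 0ℤ
    ... | no  D≰0 = cong (λ t → x j * (+ s * t)) (sym (i≥j⇒i⊔j≡i (i<j⇒suc[i]≤j (≰⇒> D≰0))))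
    ... | yes D≤0 = trans (cong (_* (+ s * D j)) x≡0) (cong (_* d j) (sym x≡0))
      where
      s*D≤0 : + s * D j ≤ 0ℤ
      s*D≤0 = subst (+ s * D j ≤_) (*-zeroʳ (+ s)) (*-monoˡ-≤-nonNeg (+ s) D≤0)
      x≡0 : x j ≡ 0ℤ
      x≡0 = trans (cong (sgn (σ j) *_) (≤-antisym (≤-trans (E*A≤s*D j) s*D≤0) (0≤E*A j))) (*-zeroʳ (sgn (σ j)))

    total : ∑³ weight ≡ + 4 * E * (d 0F * d 1F * d 2F)
    total = begin
      ∑³ weight
        ≡⟨ sum-cong-≗ (λ k → BilinearInterpolation.total (+ e k * d k) (d (punchIn k 0F)) (x (punchIn k 0F))
                                                                       (d (punchIn k 1F)) (x (punchIn k 1F))) ⟩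
      sum (λ k → + e k * d k * (+ 4 * d (punchIn k 0F) * d (punchIn k 1F)))
        ≡⟨ identity (+ e 0F) (+ e 1F) (+ e 2F) (d 0F) (d 1F) (d 2F) ⟩
      + 4 * E * (d 0F * d 1F * d 2F) ∎
      where
      identity : ∀ e₀ e₁ e₂ d₀ d₁ d₂ →
        e₀ * d₀ * (+ 4 * d₁ * d₂) + (e₁ * d₁ * (+ 4 * d₀ * d₂) + (e₂ * d₂ * (+ 4 * d₀ * d₁) + 0ℤ))
          ≡ + 4 * (e₀ + e₁ + e₂) * (d₀ * d₁ * d₂)
      identity = solve-∀

    moment : ∀ j → ∑³ (λ k a b → weight k a b * corner k a b j) ≡ + 4 * x j * P j * D j
    moment j = begin
      ∑³ (λ k a b → weight k a b * corner k a b j)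
        ≡⟨ sum-cong-≗ (λ k → BilinearInterpolation.moment (+ e k * d k) (d (punchIn k 0F)) (x (punchIn k 0F))
                               (d (punchIn k 1F)) (x (punchIn k 1F)) (δ (punchIn k 0F) j) (δ (punchIn k 1F) j)) ⟩
      sum (λ k → + e k * d k * (δ (punchIn k 0F) j * (+ 4 * x (punchIn k 0F) * d (punchIn k 1F))
                                + δ (punchIn k 1F) j * (+ 4 * d (punchIn k 0F) * x (punchIn k 1F))))
        ≡⟨ by-coordinate j ⟩
      + 4 * x j * P j * D j ∎
      where
      by-coordinate : ∀ j →
        sum (λ k → + e k * d k * (δ (punchIn k 0F) j * (+ 4 * x (punchIn k 0F) * d (punchIn k 1F))
                                  + δ (punchIn k 1F) j * (+ 4 * d (punchIn k 0F) * x (punchIn k 1F))))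
          ≡ + 4 * x j * P j * D j
      by-coordinate 0F = identity (+ e 0F) (+ e 1F) (+ e 2F) (d 0F) (d 1F) (d 2F) (x 0F) (x 1F) (x 2F)
        where
        identity : ∀ e₀ e₁ e₂ d₀ d₁ d₂ x₀ x₁ x₂ →
          e₀ * d₀ * (0ℤ * (+ 4 * x₁ * d₂) + 0ℤ * (+ 4 * d₁ * x₂))
            + (e₁ * d₁ * (1ℤ * (+ 4 * x₀ * d₂) + 0ℤ * (+ 4 * d₀ * x₂))
            + (e₂ * d₂ * (1ℤ * (+ 4 * x₀ * d₁) + 0ℤ * (+ 4 * d₀ * x₁)) + 0ℤ))
            ≡ + 4 * x₀ * (d₁ * d₂) * (e₁ + e₂)
        identity = solve-∀
      by-coordinate 1F = identity (+ e 0F) (+ e 1F) (+ e 2F) (d 0F) (d 1F) (d 2F) (x 0F) (x 1F) (x 2F)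
        where
        identity : ∀ e₀ e₁ e₂ d₀ d₁ d₂ x₀ x₁ x₂ →
          e₀ * d₀ * (1ℤ * (+ 4 * x₁ * d₂) + 0ℤ * (+ 4 * d₁ * x₂))
            + (e₁ * d₁ * (0ℤ * (+ 4 * x₀ * d₂) + 0ℤ * (+ 4 * d₀ * x₂))
            + (e₂ * d₂ * (0ℤ * (+ 4 * x₀ * d₁) + 1ℤ * (+ 4 * d₀ * x₁)) + 0ℤ))
            ≡ + 4 * x₁ * (d₀ * d₂) * (e₀ + e₂)
        identity = solve-∀
      by-coordinate 2F = identity (+ e 0F) (+ e 1F) (+ e 2F) (d 0F) (d 1F) (d 2F) (x 0F) (x 1F) (x 2F)
        where
        identity : ∀ e₀ e₁ e₂ d₀ d₁ d₂ x₀ x₁ x₂ →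
          e₀ * d₀ * (0ℤ * (+ 4 * x₁ * d₂) + 1ℤ * (+ 4 * d₁ * x₂))
            + (e₁ * d₁ * (0ℤ * (+ 4 * x₀ * d₂) + 1ℤ * (+ 4 * d₀ * x₂))
            + (e₂ * d₂ * (0ℤ * (+ 4 * x₀ * d₁) + 0ℤ * (+ 4 * d₀ * x₁)) + 0ℤ))
            ≡ + 4 * x₂ * (d₀ * d₁) * (e₀ + e₁)
        identity = solve-∀

    barycentre : ∀ j → + s * ∑³ (λ k a b → weight k a b * corner k a b j) ≡ ∑³ weight * Q j
    barycentre j = begin
      + s * ∑³ (λ k a b → weight k a b * corner k a b j) ≡⟨ cong (+ s *_) (moment j) ⟩
      + s * (+ 4 * x j * P j * D j)                       ≡⟨ regroup (+ s) (x j) (P j) (D j) ⟩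
      + 4 * P j * (x j * (+ s * D j))                     ≡⟨ cong (λ t → + 4 * P j * t) (x*s*D≡x*d j) ⟩
      + 4 * P j * (x j * d j)                             ≡⟨ factor (P j) (sgn (σ j)) E (A j) (d j) ⟩
      + 4 * E * (d j * P j) * Q j                         ≡⟨ cong (λ t → + 4 * E * t * Q j) (d*P≡∏d j) ⟩
      + 4 * E * (d 0F * d 1F * d 2F) * Q j                ≡⟨ cong (_* Q j) total ⟨
      ∑³ weight * Q j                                     ∎
      where
      regroup : ∀ s x p D → s * (+ 4 * x * p * D) ≡ + 4 * p * (x * (s * D))
      regroup = solve-∀
      factor : ∀ p σ E A d → + 4 * p * (σ * (E * A) * d) ≡ + 4 * E * (d * p) * (σ * A)
      factor = solve-∀

    cornerCombination : CornerCombination s Q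
    cornerCombination = record
      { weight        = weight
      ; weight-nonneg = weight-nonneg
      ; total-pos     = subst (0ℤ <_) (sym total) (*-pos (*-pos {+ 4} (+<+ (ℕ.s≤s ℕ.z≤n)) 0<E)
                                                         (*-pos (*-pos (0<d 0F) (0<d 1F)) (0<d 2F)))
      ; barycentre    = barycentre
      }

module FinSum {c ℓ} (M : Monoid c ℓ) where

  open import Function using (_∘_)
  open import Data.Nat using (zero; suc; _+_; _*_)
  open import Data.Fin as Fin using (Fin; combine; remQuot; _↑ˡ_; _↑ʳ_)
  open import Data.Fin.Properties using (remQuot-combine)
  open import Data.Product using (uncurry)
  open import Relation.Binary.PropositionalEquality using (cong)
  open Monoid M using (Carrier; _≈_; _∙_; refl; sym; trans; reflexive; ∙-congˡ; identityˡ; assoc)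
  open import Algebra.Properties.Monoid.Sum M using (sum; sum-cong-≗)

  sum-↑ : ∀ m {n} (f : Fin (m + n) → Carrier) → sum f ≈ sum (f ∘ (_↑ˡ n)) ∙ sum (f ∘ (m ↑ʳ_))
  sum-↑ zero    f = sym (identityˡ _)
  sum-↑ (suc m) f = trans (∙-congˡ (sum-↑ m (f ∘ Fin.suc))) (sym (assoc _ _ _))

  sum-combine : ∀ m n (f : Fin (m * n) → Carrier) →
                sum f ≈ sum (λ (i : Fin m) → sum (λ (j : Fin n) → f (combine i j)))
  sum-combine zero    n f = refl
  sum-combine (suc m) n f = trans (sum-↑ n f) (∙-congˡ (sum-combine m n (f ∘ (n ↑ʳ_))))

  sum-remQuot : ∀ m n (g : Fin m → Fin n → Carrier) → sum (uncurry g ∘ remQuot {m} n) ≈ sum (λ i → sum (g i))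
  sum-remQuot m n g = trans (sum-combine m n (uncurry g ∘ remQuot n))
    (reflexive (sum-cong-≗ λ i → sum-cong-≗ λ j → cong (uncurry g) (remQuot-combine i j)))

module Dilation where

  open CornerWeights
  open import Function using (_∘_)
  open import Data.Nat as ℕ using (ℕ; zero; suc; z≤n)
  open import Data.Fin using (Fin; zero; suc; remQuot)
  open import Data.Fin.Patterns using (0F; 1F; 2F)
  import Data.Fin.Properties as Fin
  open import Data.Integer as ℤ using (ℤ; +_; 0ℤ; 1ℤ)
  import Data.Integer.Properties as ℤ
  open import Data.Integer.Tactic.RingSolver using (solve-∀)
  open import Data.Rational as ℚ using (ℚ; mkℚ; 0ℚ; 1ℚ; ½; _+_; _*_; _≤_; _/_)
  import Data.Rational.Properties as ℚ
  import Data.Rational.Unnormalised as ℚᵘ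
  import Data.Rational.Unnormalised.Properties as ℚᵘ
  open import Data.Rational.Solver using (module +-*-Solver)
  open +-*-Solver using (solve; _:*_; _:+_; _:=_; con)
  open import Data.Nat.Divisibility using (∣1⇒≡1)
  open import Algebra.Bundles using (CommutativeRing)
  import Algebra.Properties.Semiring.Sum
  open import Data.Product using (_×_; _,_; proj₁; proj₂; uncurry)
  open import Relation.Nullary.Decidable using (from-yes)
  open import Relation.Binary.PropositionalEquality

  module ℤΣ = Algebra.Properties.Semiring.Sum ℤ.+-*-semiring
  open Algebra.Properties.Semiring.Sum (CommutativeRing.semiring ℚ.+-*-commutativeRing)
    using (sum; sum-cong-≗; ∑-distrib-+; ∑-comm; *-distribˡ-sum; *-distribʳ-sum)

  ι : ℤ → ℚ
  ι i = mkℚ i 0 (λ {d} p → ∣1⇒≡1 (proj₂ p))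

  ι-/1 : ∀ i → i / 1 ≡ ι i
  ι-/1 i = ℚ.↥p/↧p≡p (ι i)

  ι-+ : ∀ i j → ι (i ℤ.+ j) ≡ ι i + ι j
  ι-+ i j = ℚ.toℚᵘ-injective
    (ℚᵘ.≃-trans (ℚᵘ.*≡* (identity i j)) (ℚᵘ.≃-sym (ℚ.toℚᵘ-homo-+ (ι i) (ι j))))
    where identity : ∀ i j → (i ℤ.+ j) ℤ.* + 1 ≡ (i ℤ.* + 1 ℤ.+ j ℤ.* + 1) ℤ.* + 1
          identity = solve-∀

  ι-* : ∀ i j → ι (i ℤ.* j) ≡ ι i * ι j
  ι-* i j = ℚ.toℚᵘ-injective (ℚᵘ.≃-trans (ℚᵘ.*≡* refl) (ℚᵘ.≃-sym (ℚ.toℚᵘ-homo-* (ι i) (ι j))))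

  ι-mono-≤ : ∀ {i j} → i ℤ.≤ j → ι i ≤ ι j
  ι-mono-≤ {i} {j} i≤j = ℚ.*≤* (subst₂ ℤ._≤_ (sym (ℤ.*-identityʳ i)) (sym (ℤ.*-identityʳ j)) i≤j)

  ι-cancel-≤ : ∀ {i j} → ι i ≤ ι j → i ℤ.≤ j
  ι-cancel-≤ {i} {j} (ℚ.*≤* i≤j) = subst₂ ℤ._≤_ (ℤ.*-identityʳ i) (ℤ.*-identityʳ j) i≤j

  ι-∑ : ∀ {n} (f : Fin n → ℤ) → sum (ι ∘ f) ≡ ι (ℤΣ.sum f)
  ι-∑ {zero}  f = refl
  ι-∑ {suc n} f = trans (cong (λ t → ι (f zero) + t) (ι-∑ (f ∘ suc))) (sym (ι-+ (f zero) _))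

  sumFin≡sum : ∀ n (f : Fin n → ℚ) → sumFin n f ≡ sum f
  sumFin≡sum zero    f = refl
  sumFin≡sum (suc n) f = cong (λ t → f zero + t) (sumFin≡sum n (f ∘ suc))

  ∑-mono-≤ : ∀ {n} {f g : Fin n → ℚ} → (∀ i → f i ≤ g i) → sum f ≤ sum g
  ∑-mono-≤ {zero}  f≤g = ℚ.≤-refl
  ∑-mono-≤ {suc n} f≤g = ℚ.+-mono-≤ (f≤g zero) (∑-mono-≤ (f≤g ∘ suc))

  ∑-linear : ∀ {n} a b (f g : Fin n → ℚ) → sum (λ i → a * f i + b * g i) ≡ a * sum f + b * sum g
  ∑-linear a b f g = trans (∑-distrib-+ (λ i → a * f i) (λ i → b * g i))
                           (sym (cong₂ _+_ (*-distribˡ-sum a f) (*-distribˡ-sum b g)))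

  average-≤ : ∀ {n} {w g : Fin n → ℚ} {β} → (∀ i → 0ℚ ≤ w i) → sum w ≡ 1ℚ →
              (∀ i → g i ≤ β) → sum (λ i → w i * g i) ≤ β
  average-≤ {w = w} {g} {β} w≥0 ∑w≡1 g≤β = begin
    sum (λ i → w i * g i) ≤⟨ ∑-mono-≤ (λ i → ℚ.*-monoˡ-≤-nonNeg (w i) {{ℚ.nonNegative (w≥0 i)}} (g≤β i)) ⟩
    sum (λ i → w i * β)   ≡⟨ *-distribʳ-sum β w ⟨
    sum w * β             ≡⟨ cong (_* β) ∑w≡1 ⟩
    1ℚ * β                ≡⟨ ℚ.*-identityˡ β ⟩
    β                     ∎
    where open ℚ.≤-Reasoning

  ⟨_,_,_⟩ : ∀ {A : Set} → A → A → A → Fin 3 → A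
  ⟨ a , b , c ⟩ 0F = a
  ⟨ a , b , c ⟩ 1F = b
  ⟨ a , b , c ⟩ 2F = c

  coords : Lattice → Fin 3 → ℤ
  coords (a , b , c) = ⟨ a , b , c ⟩

  toPt≡ι∘coords : ∀ p j → toPt p j ≡ ι (coords p j)
  toPt≡ι∘coords (a , b , c) 0F = ι-/1 a
  toPt≡ι∘coords (a , b , c) 1F = ι-/1 b
  toPt≡ι∘coords (a , b , c) 2F = ι-/1 c

  functional-bound : ∀ {s p} → InDilate s p → ∀ (c : Fin 3 → ℚ) β →
    (∀ i → sum (λ j → c j * vertex i j) ≤ β) → sum (λ j → c j * p j) ≤ (+ s / 1) * β
  functional-bound {s} {p} (λ′ , λ′≥0 , ∑λ′≡1 , centroid) c β c·v≤β = begin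
    sum (λ j → c j * p j)
      ≡⟨ sum-cong-≗ (λ j → cong (c j *_)
           (trans (sym (centroid j)) (sumFin≡sum 12 λ i → λ′ i * (S * vertex i j)))) ⟩
    sum (λ j → c j * sum (λ i → λ′ i * (S * vertex i j)))
      ≡⟨ sum-cong-≗ (λ j → *-distribˡ-sum (c j) λ i → λ′ i * (S * vertex i j)) ⟩
    sum (λ j → sum (λ i → c j * (λ′ i * (S * vertex i j))))
      ≡⟨ ∑-comm (λ j i → c j * (λ′ i * (S * vertex i j))) ⟩
    sum (λ i → sum (λ j → c j * (λ′ i * (S * vertex i j))))
      ≡⟨ sum-cong-≗ pull-out ⟩
    sum (λ i → λ′ i * (S * sum (λ j → c j * vertex i j)))
      ≤⟨ average-≤ λ′≥0 (trans (sym (sumFin≡sum 12 λ′)) ∑λ′≡1)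
                    (λ i → ℚ.*-monoˡ-≤-nonNeg S {{S≥0}} (c·v≤β i)) ⟩
    S * β ∎
    where
    open ℚ.≤-Reasoning
    S = + s / 1
    S≥0 : ℚ.NonNegative S
    S≥0 = ℚ.nonNegative (subst (0ℚ ≤_) (sym (ι-/1 (+ s))) (ι-mono-≤ (ℤ.+≤+ z≤n)))
    pull-out : ∀ i → sum (λ j → c j * (λ′ i * (S * vertex i j))) ≡ λ′ i * (S * sum (λ j → c j * vertex i j))
    pull-out i = trans (sum-cong-≗ λ j → rearrange (c j) (λ′ i) S (vertex i j))
                       (trans (sym (*-distribˡ-sum (λ′ i * S) λ j → c j * vertex i j)) (ℚ.*-assoc (λ′ i) S _))
      where rearrange : ∀ c l S v → c * (l * (S * v)) ≡ l * S * (c * v)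
            rearrange = solve 4 (λ c l S v → c :* (l :* (S :* v)) := l :* S :* (c :* v)) refl

  lattice-functional-bound : ∀ {s} a → InDilate s (toPt a) → ∀ (c : Fin 3 → ℤ) β →
    (∀ i → sum (λ j → ι (c j) * vertex i j) ≤ ι β) → ℤΣ.sum (λ j → c j ℤ.* coords a j) ℤ.≤ + s ℤ.* β
  lattice-functional-bound {s} a inside c β c·v≤β =
    ι-cancel-≤ (subst₂ _≤_ lhs rhs (functional-bound {s} {toPt a} inside (ι ∘ c) (ι β) c·v≤β))
    where
    lhs : sum (λ j → ι (c j) * toPt a j) ≡ ι (ℤΣ.sum (λ j → c j ℤ.* coords a j))
    lhs = trans (sum-cong-≗ λ j → trans (cong (ι (c j) *_) (toPt≡ι∘coords a j)) (sym (ι-* (c j) (coords a j))))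
                (ι-∑ (λ j → c j ℤ.* coords a j))
    rhs : (+ s / 1) * ι β ≡ ι (+ s ℤ.* β)
    rhs = trans (cong (_* ι β) (ι-/1 (+ s))) (sym (ι-* (+ s) β))

  vertex-upper-bounds : ∀ j i → sum (λ j′ → ι (δ j j′) * vertex i j′) ≤ ι 1ℤ
  vertex-upper-bounds = from-yes (Fin.all? λ j → Fin.all? λ i →
    sum (λ j′ → ι (δ j j′) * vertex i j′) ℚ.≤? ι 1ℤ)

  vertex-lower-bounds : ∀ j i → sum (λ j′ → ι (ℤ.- δ j j′) * vertex i j′) ≤ ι 0ℤ
  vertex-lower-bounds = from-yes (Fin.all? λ j → Fin.all? λ i →
    sum (λ j′ → ι (ℤ.- δ j j′) * vertex i j′) ℚ.≤? ι 0ℤ)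

  vertex-octant-bounds : ∀ σ₀ σ₁ σ₂ i →
    sum (λ j → ι (+ 2 ℤ.* sgn (⟨ σ₀ , σ₁ , σ₂ ⟩ j)) * vertex i j)
      ≤ ι (+ 2 ℤ.+ ℤΣ.sum (sgn ∘ ⟨ σ₀ , σ₁ , σ₂ ⟩))
  vertex-octant-bounds = from-yes (Fin.all? λ σ₀ → Fin.all? λ σ₁ → Fin.all? λ σ₂ → Fin.all? λ i →
    sum (λ j → ι (+ 2 ℤ.* sgn (⟨ σ₀ , σ₁ , σ₂ ⟩ j)) * vertex i j)
      ℚ.≤? ι (+ 2 ℤ.+ ℤΣ.sum (sgn ∘ ⟨ σ₀ , σ₁ , σ₂ ⟩)))

  vertexSquare : Fin 12 → Fin 3
  vertexSquare i = proj₁ (remQuot {3} 4 i)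

  vertexSigns : Fin 12 → Fin 2 × Fin 2
  vertexSigns i = remQuot {2} 2 (proj₂ (remQuot {3} 4 i))

  atVertex : ∀ {A : Set} → (Fin 3 → Fin 2 → Fin 2 → A) → Fin 12 → A
  atVertex w i = w (vertexSquare i) (proj₁ (vertexSigns i)) (proj₂ (vertexSigns i))

  ∑-atVertex : ∀ w → ℤΣ.sum (atVertex w) ≡ ∑³ w
  ∑-atVertex w = trans (ℤFinSum.sum-remQuot 3 4 (λ k → uncurry (w k) ∘ remQuot 2))
                       (ℤΣ.sum-cong-≗ λ k → ℤFinSum.sum-remQuot 2 2 (w k))
    where module ℤFinSum = FinSum (CommutativeRing.+-monoid ℤ.+-*-commutativeRing)

  ε : Fin 12 → Fin 3 → ℤ
  ε i j = atVertex (λ k a b → corner k a b j) i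

  vertex-centred : ∀ i j → vertex i j ≡ ½ * (1ℚ + ι (ε i j))
  vertex-centred = from-yes (Fin.all? λ i → Fin.all? λ j → vertex i j ℚ.≟ ½ * (1ℚ + ι (ε i j)))

  dilated-coordinate : ∀ s (λ′ : Fin 12 → ℚ) j →
    sum (λ i → λ′ i * ((+ s / 1) * vertex i j))
      ≡ ½ * ((+ s / 1) * sum λ′ + (+ s / 1) * sum (λ i → λ′ i * ι (ε i j)))
  dilated-coordinate s λ′ j = begin
    sum (λ i → λ′ i * (S * vertex i j))
      ≡⟨ sum-cong-≗ (λ i → trans (cong (λ v → λ′ i * (S * v)) (vertex-centred i j))
                                 (split (λ′ i) S (ι (ε i j)))) ⟩
    sum (λ i → ½ * S * λ′ i + ½ * S * (λ′ i * ι (ε i j)))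
      ≡⟨ ∑-linear (½ * S) (½ * S) λ′ (λ i → λ′ i * ι (ε i j)) ⟩
    ½ * S * sum λ′ + ½ * S * sum (λ i → λ′ i * ι (ε i j))
      ≡⟨ merge ½ S (sum λ′) _ ⟩
    ½ * (S * sum λ′ + S * sum (λ i → λ′ i * ι (ε i j))) ∎
    where
    open ≡-Reasoning
    S = + s / 1
    split : ∀ l S e → l * (S * (½ * (1ℚ + e))) ≡ ½ * S * l + ½ * S * (l * e)
    split = solve 3 (λ l S e → l :* (S :* (con ½ :* (con 1ℚ :+ e)))
                             := con ½ :* S :* l :+ con ½ :* S :* (l :* e)) refl
    merge : ∀ h S x y → h * S * x + h * S * y ≡ h * (S * x + S * y)
    merge = solve 4 (λ h S x y → h :* S :* x :+ h :* S :* y := h :* (S :* x :+ S :* y)) refl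

  module Normalised {s Q} (C : CornerCombination s Q) where

    open CornerCombination C

    t : ℤ
    t = ∑³ weight

    instance
      t-pos : ℚ.Positive (ι t)
      t-pos = ℤ.positive total-pos
      t-nonZero : ℚ.NonZero (ι t)
      t-nonZero = ℚ.pos⇒nonZero (ι t)
      t⁻¹-nonNeg : ℚ.NonNegative (ℚ.1/ ι t)
      t⁻¹-nonNeg = ℚ.pos⇒nonNeg (ℚ.1/ ι t) {{ℚ.1/pos⇒pos (ι t)}}

    t⁻¹ : ℚ
    t⁻¹ = ℚ.1/ ι t

    λ′ : Fin 12 → ℚ
    λ′ i = t⁻¹ * ι (atVertex weight i)

    λ′≥0 : ∀ i → 0ℚ ≤ λ′ i
    λ′≥0 i = subst (_≤ λ′ i) (ℚ.*-zeroʳ t⁻¹) (ℚ.*-monoˡ-≤-nonNeg t⁻¹ (ι-mono-≤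
               (weight-nonneg (vertexSquare i) (proj₁ (vertexSigns i)) (proj₂ (vertexSigns i)))))

    ∑-normalised : ∀ w → sum (λ i → t⁻¹ * ι (atVertex w i)) ≡ t⁻¹ * ι (∑³ w)
    ∑-normalised w = trans (sym (*-distribˡ-sum t⁻¹ (ι ∘ atVertex w)))
                           (cong (t⁻¹ *_) (trans (ι-∑ (atVertex w)) (cong ι (∑-atVertex w))))

    ∑λ′≡1 : sum λ′ ≡ 1ℚ
    ∑λ′≡1 = trans (∑-normalised weight) (ℚ.*-inverseˡ (ι t))

    dilated-mean : ∀ j → (+ s / 1) * sum (λ i → λ′ i * ι (ε i j)) ≡ ι (Q j)
    dilated-mean j = begin
      S * sum (λ i → λ′ i * ι (ε i j))
        ≡⟨ cong (S *_) (sum-cong-≗ λ i → trans (ℚ.*-assoc t⁻¹ (ι (atVertex weight i)) (ι (ε i j)))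
                                               (cong (t⁻¹ *_) (sym (ι-* (atVertex weight i) (ε i j))))) ⟩
      S * sum (λ i → t⁻¹ * ι (atVertex (weight·corner j) i))
        ≡⟨ cong (S *_) (∑-normalised (weight·corner j)) ⟩
      S * (t⁻¹ * ι (∑³ (weight·corner j)))
        ≡⟨ swap S t⁻¹ _ ⟩
      t⁻¹ * (S * ι (∑³ (weight·corner j)))
        ≡⟨ cong (t⁻¹ *_) (trans (cong (_* ι _) (ι-/1 (+ s))) (sym (ι-* (+ s) _))) ⟩
      t⁻¹ * ι (+ s ℤ.* ∑³ (weight·corner j))
        ≡⟨ cong (λ m → t⁻¹ * ι m) (barycentre j) ⟩
      t⁻¹ * ι (t ℤ.* Q j)
        ≡⟨ trans (cong (t⁻¹ *_) (ι-* t (Q j))) (sym (ℚ.*-assoc t⁻¹ (ι t) (ι (Q j)))) ⟩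
      t⁻¹ * ι t * ι (Q j)
        ≡⟨ trans (cong (_* ι (Q j)) (ℚ.*-inverseˡ (ι t))) (ℚ.*-identityˡ (ι (Q j))) ⟩
      ι (Q j) ∎
      where
      open ≡-Reasoning
      S = + s / 1
      weight·corner : Fin 3 → Fin 3 → Fin 2 → Fin 2 → ℤ
      weight·corner j k a b = weight k a b ℤ.* corner k a b j
      swap : ∀ x y z → x * (y * z) ≡ y * (x * z)
      swap = solve 3 (λ x y z → x :* (y :* z) := y :* (x :* z)) refl

  combination⇒InDilate : ∀ {s Q} → CornerCombination s Q → ∀ a →
    (∀ j → Q j ≡ + 2 ℤ.* coords a j ℤ.- + s) → InDilate s (toPt a)
  combination⇒InDilate {s} {Q} C a Q≡2a-s = λ′ , λ′≥0 , trans (sumFin≡sum 12 λ′) ∑λ′≡1 , centroid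
    where
    open Normalised C
    S = + s / 1
    centroid : ∀ j → sumFin 12 (λ i → λ′ i * (S * vertex i j)) ≡ toPt a j
    centroid j = begin
      sumFin 12 (λ i → λ′ i * (S * vertex i j))            ≡⟨ sumFin≡sum 12 (λ i → λ′ i * (S * vertex i j)) ⟩
      sum (λ i → λ′ i * (S * vertex i j))                  ≡⟨ dilated-coordinate s λ′ j ⟩
      ½ * (S * sum λ′ + S * sum (λ i → λ′ i * ι (ε i j)))
        ≡⟨ cong₂ (λ u v → ½ * (S * u + v)) ∑λ′≡1 (dilated-mean j) ⟩
      ½ * (S * 1ℚ + ι (Q j))                                ≡⟨ cong (λ u → ½ * (u + ι (Q j))) (ℚ.*-identityʳ S) ⟩
      ½ * (S + ι (Q j))                                     ≡⟨ cong (λ u → ½ * (u + ι (Q j))) (ι-/1 (+ s)) ⟩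
      ½ * (ι (+ s) + ι (Q j))                               ≡⟨ cong (½ *_) (ι-+ (+ s) (Q j)) ⟨
      ½ * ι (+ s ℤ.+ Q j)                                    ≡⟨ cong (λ q → ½ * ι (+ s ℤ.+ q)) (Q≡2a-s j) ⟩
      ½ * ι (+ s ℤ.+ (+ 2 ℤ.* coords a j ℤ.- + s))           ≡⟨ cong (λ q → ½ * ι q) (cancel (+ s) (coords a j)) ⟩
      ½ * ι (+ 2 ℤ.* coords a j)                             ≡⟨ cong (½ *_) (ι-* (+ 2) (coords a j)) ⟩
      ½ * (ι (+ 2) * ι (coords a j))                         ≡⟨ ℚ.*-assoc ½ (ι (+ 2)) (ι (coords a j)) ⟨
      ½ * ι (+ 2) * ι (coords a j)                           ≡⟨ ℚ.*-identityˡ (ι (coords a j)) ⟩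
      ι (coords a j)                                         ≡⟨ toPt≡ι∘coords a j ⟨
      toPt a j                                               ∎
      where
      open ≡-Reasoning
      cancel : ∀ s x → s ℤ.+ (+ 2 ℤ.* x ℤ.- s) ≡ + 2 ℤ.* x
      cancel = solve-∀

module LatticeMembership where

  open Counting using (fold; Uncut)
  open CornerWeights
  open Dilation
  open import Function using (_∘_)
  open import Data.Nat as ℕ using (ℕ; _∸_)
  import Data.Nat.Properties as ℕ
  open import Data.Fin using (Fin)
  open import Data.Fin.Patterns using (0F; 1F; 2F)
  open import Data.Integer using (ℤ; +_; 0ℤ; 1ℤ; -1ℤ; -_; _+_; _*_; _-_; _≤_; +≤+)
  import Data.Integer.Properties as ℤ
  open import Data.Integer.Tactic.RingSolver using (solve-∀)
  open import Data.Product using (∃; _×_; _,_; proj₁; proj₂)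
  open import Relation.Nullary using (yes; no)
  open import Relation.Binary.PropositionalEquality

  2*fold≤s : ∀ {s x} → x ℕ.≤ s → 2 ℕ.* fold s x ℕ.≤ s
  2*fold≤s {s} {x} x≤s = begin
    2 ℕ.* fold s x            ≡⟨ cong (fold s x ℕ.+_) (ℕ.+-identityʳ (fold s x)) ⟩
    fold s x ℕ.+ fold s x     ≤⟨ ℕ.+-mono-≤ (ℕ.m⊓n≤m x (s ∸ x)) (ℕ.m⊓n≤n x (s ∸ x)) ⟩
    x ℕ.+ (s ∸ x)             ≡⟨ ℕ.m+[n∸m]≡n x≤s ⟩
    s                         ∎
    where open ℕ.≤-Reasoning

  centre-offset : ∀ {s x} → x ℕ.≤ s → ∃ λ σ → + 2 * + x - + s ≡ sgn σ * (+ s - + 2 * + fold s x)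
  centre-offset {s} {x} x≤s with x ℕ.≤? s ∸ x
  ... | yes x≤s-x =
    0F , trans (identity (+ s) (+ x)) (cong (λ e → -1ℤ * (+ s - + 2 * + e)) (sym (ℕ.m≤n⇒m⊓n≡m x≤s-x)))
    where identity : ∀ s x → + 2 * x - s ≡ -1ℤ * (s - + 2 * x)
          identity = solve-∀
  ... | no  x≰s-x = 1F , trans (identity (+ s) (+ x)) (cong (λ e → 1ℤ * (+ s - + 2 * e)) s-x≡fold)
    where identity : ∀ s x → + 2 * x - s ≡ 1ℤ * (s - + 2 * (s - x))
          identity = solve-∀
          s-x≡fold : + s - + x ≡ + fold s x
          s-x≡fold = trans (ℤ.m-n≡m⊖n s x)
                           (trans (ℤ.⊖-≥ x≤s) (cong +_ (sym (ℕ.m≥n⇒m⊓n≡n (ℕ.<⇒≤ (ℕ.≰⇒> x≰s-x))))))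

  InBox : ℕ → ℕ × ℕ × ℕ → Set
  InBox s (x , y , z) = x ℕ.≤ s × y ℕ.≤ s × z ℕ.≤ s

  toZ : ℕ × ℕ × ℕ → Lattice
  toZ (x , y , z) = + x , + y , + z

  uncut⇒InDilate : ∀ {s} → 1 ℕ.≤ s → ∀ p → InBox s p → Uncut s p → InDilate s (toPt (toZ p))
  uncut⇒InDilate {s} 1≤s (x , y , z) (x≤s , y≤s , z≤s) uncut =
    combination⇒InDilate (CuboctahedronWeights.cornerCombination s e σ 1≤s (2*fold≤s ∘ bound) uncut)
                         (toZ (x , y , z)) offset
    where
    bound : ∀ j → ⟨ x , y , z ⟩ j ℕ.≤ s
    bound 0F = x≤s
    bound 1F = y≤s
    bound 2F = z≤s
    e : Fin 3 → ℕ
    e j = fold s (⟨ x , y , z ⟩ j)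
    σ : Fin 3 → Fin 2
    σ j = proj₁ (centre-offset (bound j))
    offset : ∀ j → sgn (σ j) * (+ s - + 2 * + e j) ≡ + 2 * coords (toZ (x , y , z)) j - + s
    offset 0F = sym (proj₂ (centre-offset x≤s))
    offset 1F = sym (proj₂ (centre-offset y≤s))
    offset 2F = sym (proj₂ (centre-offset z≤s))

  InDilate⇒InBox : ∀ {s} p → InDilate s (toPt p) → ∀ j → 0ℤ ≤ coords p j × coords p j ≤ + s
  InDilate⇒InBox {s} p inside j = ℤ.neg-cancel-≤ -c≤0 , c≤s
    where
    c≤s : coords p j ≤ + s
    c≤s = subst₂ _≤_ (∑-δ j (coords p)) (ℤ.*-identityʳ (+ s))
            (lattice-functional-bound {s} p inside (δ j) 1ℤ (vertex-upper-bounds j))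
    negate : ∀ j′ → - δ j j′ * coords p j′ ≡ δ j j′ * - coords p j′
    negate j′ = trans (sym (ℤ.neg-distribˡ-* (δ j j′) (coords p j′))) (ℤ.neg-distribʳ-* (δ j j′) (coords p j′))
    -c≤0 : - coords p j ≤ 0ℤ
    -c≤0 = subst₂ _≤_ (trans (ℤΣ.sum-cong-≗ negate) (∑-δ j λ j′ → - coords p j′)) (ℤ.*-zeroʳ (+ s))
             (lattice-functional-bound {s} p inside (λ j′ → - δ j j′) 0ℤ (vertex-lower-bounds j))

  sgn*sgn≡1 : ∀ σ → sgn σ * sgn σ ≡ 1ℤ
  sgn*sgn≡1 0F = refl
  sgn*sgn≡1 1F = refl

  octant-term : ∀ σ {x s A} → + 2 * x - s ≡ sgn σ * A → + 2 * sgn σ * x ≡ sgn σ * s + A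
  octant-term σ {x} {s} {A} offset = begin
    + 2 * sgn σ * x                     ≡⟨ identity (sgn σ) x s ⟩
    sgn σ * s + sgn σ * (+ 2 * x - s)   ≡⟨ cong (λ t → sgn σ * s + sgn σ * t) offset ⟩
    sgn σ * s + sgn σ * (sgn σ * A)     ≡⟨ cong (λ t → sgn σ * s + t) (ℤ.*-assoc (sgn σ) (sgn σ) A) ⟨
    sgn σ * s + sgn σ * sgn σ * A       ≡⟨ cong (λ t → sgn σ * s + t * A) (sgn*sgn≡1 σ) ⟩
    sgn σ * s + 1ℤ * A                  ≡⟨ cong (λ t → sgn σ * s + t) (ℤ.*-identityˡ A) ⟩
    sgn σ * s + A                       ∎
    where
    open ≡-Reasoning
    identity : ∀ σ x s → + 2 * σ * x ≡ σ * s + σ * (+ 2 * x - s)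
    identity = solve-∀

  -- Of the eight triangular facets, use the one facing the octant of 2 p - s.
  InDilate⇒Uncut : ∀ {s} p → InBox s p → InDilate s (toPt (toZ p)) → Uncut s p
  InDilate⇒Uncut {s} (x , y , z) (x≤s , y≤s , z≤s) inside = ℤ.drop‿+≤+ (subst (+ s ≤_) cast s≤2E)
    where
    σ₀ = proj₁ (centre-offset x≤s)
    σ₁ = proj₁ (centre-offset y≤s)
    σ₂ = proj₁ (centre-offset z≤s)
    e₀ = + fold s x
    e₁ = + fold s y
    e₂ = + fold s z
    octant-bound : ℤΣ.sum (λ j → + 2 * sgn (⟨ σ₀ , σ₁ , σ₂ ⟩ j) * coords (toZ (x , y , z)) j)
                     ≤ + s * (+ 2 + ℤΣ.sum (sgn ∘ ⟨ σ₀ , σ₁ , σ₂ ⟩))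
    octant-bound = lattice-functional-bound {s} (toZ (x , y , z)) inside (λ j → + 2 * sgn (⟨ σ₀ , σ₁ , σ₂ ⟩ j))
                     (+ 2 + ℤΣ.sum (sgn ∘ ⟨ σ₀ , σ₁ , σ₂ ⟩)) (vertex-octant-bounds σ₀ σ₁ σ₂)
    centred : sgn σ₀ * + s + (+ s - + 2 * e₀) + (sgn σ₁ * + s + (+ s - + 2 * e₁)
                + (sgn σ₂ * + s + (+ s - + 2 * e₂) + 0ℤ))
                ≤ + s * (+ 2 + (sgn σ₀ + (sgn σ₁ + (sgn σ₂ + 0ℤ))))
    centred = subst (_≤ + s * (+ 2 + (sgn σ₀ + (sgn σ₁ + (sgn σ₂ + 0ℤ)))))
                (cong₂ _+_ (octant-term σ₀ (proj₂ (centre-offset x≤s)))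
                (cong₂ _+_ (octant-term σ₁ (proj₂ (centre-offset y≤s)))
                (cong (_+ 0ℤ) (octant-term σ₂ (proj₂ (centre-offset z≤s)))))) octant-bound
    gap : ∀ S σ₀ σ₁ σ₂ e₀ e₁ e₂ →
      S * (+ 2 + (σ₀ + (σ₁ + (σ₂ + 0ℤ))))
        - (σ₀ * S + (S - + 2 * e₀) + (σ₁ * S + (S - + 2 * e₁) + (σ₂ * S + (S - + 2 * e₂) + 0ℤ)))
        ≡ + 2 * (e₀ + e₁ + e₂) - S
    gap = solve-∀
    s≤2E : + s ≤ + 2 * (e₀ + e₁ + e₂)
    s≤2E = ℤ.0≤i-j⇒j≤i (subst (0ℤ ≤_) (gap (+ s) (sgn σ₀) (sgn σ₁) (sgn σ₂) e₀ e₁ e₂)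
                                      (ℤ.i≤j⇒0≤j-i centred))
    cast : + 2 * (e₀ + e₁ + e₂) ≡ + (2 ℕ.* (fold s x ℕ.+ fold s y ℕ.+ fold s z))
    cast = sym (trans (ℤ.pos-* 2 (fold s x ℕ.+ fold s y ℕ.+ fold s z))
                      (cong (+ 2 *_) (trans (ℤ.pos-+ (fold s x ℕ.+ fold s y) (fold s z))
                                            (cong (_+ e₂) (ℤ.pos-+ (fold s x) (fold s y))))))

  ℤ-in-[0,s] : ∀ {a s} → 0ℤ ≤ a × a ≤ + s → ∃ λ x → a ≡ + x × x ℕ.≤ s
  ℤ-in-[0,s] {+ x} (_ , +≤+ x≤s) = x , refl , x≤s

  InDilate⇒uncut : ∀ {s} p → InDilate s (toPt p) → ∃ λ q → p ≡ toZ q × InBox s q × Uncut s q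
  InDilate⇒uncut {s} p@(a₀ , a₁ , a₂) inside =
    natural (ℤ-in-[0,s] (InDilate⇒InBox p inside 0F)) (ℤ-in-[0,s] (InDilate⇒InBox p inside 1F))
            (ℤ-in-[0,s] (InDilate⇒InBox p inside 2F))
    where
    natural : (∃ λ x → a₀ ≡ + x × x ℕ.≤ s) → (∃ λ y → a₁ ≡ + y × y ℕ.≤ s) →
              (∃ λ z → a₂ ≡ + z × z ℕ.≤ s) → ∃ λ q → p ≡ toZ q × InBox s q × Uncut s q
    natural (x , refl , x≤s) (y , refl , y≤s) (z , refl , z≤s) =
      (x , y , z) , refl , (x≤s , y≤s , z≤s) , InDilate⇒Uncut (x , y , z) (x≤s , y≤s , z≤s) inside

open Counting
open Dilation
open LatticeMembership
open import Function using (_∘_; _⇔_; mk⇔; Equivalence)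
open import Data.Nat using (ℕ; suc; _+_; _*_; _^_; _%_; _≤_; s≤s; s≤s⁻¹; ⌈_/2⌉)
open import Data.Nat.Properties using (*-suc; *-comm; +-cancelʳ-≡)
open import Data.Nat.DivMod using (_/_; m≡m%n+[m/n]*n)
open import Data.Nat.Tactic.RingSolver using (solve-∀)
open import Data.List using (List; map; filter; upTo)
open import Data.List.Properties using (length-map)
open import Data.List.Membership.Propositional using (_∈_)
open import Data.List.Membership.Propositional.Properties
  using (∈-map⁺; ∈-map⁻; ∈-filter⁺; ∈-filter⁻; ∈-cartesianProduct⁺; ∈-cartesianProduct⁻; ∈-upTo⁺; ∈-upTo⁻)
open import Data.List.Relation.Unary.Unique.Propositional using (Unique)
import Data.List.Relation.Unary.Unique.Propositional.Properties as Unique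
open import Data.Product using (_×_; _,_; ∃-syntax)
open import Relation.Binary.PropositionalEquality
open ≡-Reasoning

toZ-injective : ∀ {p q} → toZ p ≡ toZ q → p ≡ q
toZ-injective {x , y , z} refl = refl

∈-cube⇔InBox : ∀ {s p} → p ∈ cube (suc s) ⇔ InBox s p
∈-cube⇔InBox {s} {x , y , z} = mk⇔ to from
  where
  to : (x , y , z) ∈ cube (suc s) → InBox s (x , y , z)
  to p∈ = let x∈ , yz∈ = ∈-cartesianProduct⁻ (upTo (suc s)) _ p∈
              y∈ , z∈ = ∈-cartesianProduct⁻ (upTo (suc s)) (upTo (suc s)) yz∈
          in s≤s⁻¹ (∈-upTo⁻ x∈) , s≤s⁻¹ (∈-upTo⁻ y∈) , s≤s⁻¹ (∈-upTo⁻ z∈)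
  from : InBox s (x , y , z) → (x , y , z) ∈ cube (suc s)
  from (x≤s , y≤s , z≤s) =
    ∈-cartesianProduct⁺ (∈-upTo⁺ (s≤s x≤s)) (∈-cartesianProduct⁺ (∈-upTo⁺ (s≤s y≤s)) (∈-upTo⁺ (s≤s z≤s)))

lattice-points : ℕ → List Lattice
lattice-points s = map toZ (filter (uncut? s) (cube (suc s)))

lattice-points-unique : ∀ s → Unique (lattice-points s)
lattice-points-unique s = Unique.map⁺ toZ-injective (Unique.filter⁺ (uncut? s)
  (Unique.cartesianProduct⁺ (Unique.upTo⁺ (suc s))
    (Unique.cartesianProduct⁺ (Unique.upTo⁺ (suc s)) (Unique.upTo⁺ (suc s)))))

∈-lattice-points⇔InDilate : ∀ {s} → 1 ≤ s → ∀ p → p ∈ lattice-points s ⇔ InDilate s (toPt p)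
∈-lattice-points⇔InDilate {s} 1≤s p = mk⇔ to from
  where
  to : p ∈ lattice-points s → InDilate s (toPt p)
  to p∈ = let q , q∈ , p≡q = ∈-map⁻ toZ p∈
              q∈cube , uncut = ∈-filter⁻ (uncut? s) q∈
          in subst (InDilate s ∘ toPt) (sym p≡q) (uncut⇒InDilate 1≤s q (Equivalence.to ∈-cube⇔InBox q∈cube) uncut)
  from : InDilate s (toPt p) → p ∈ lattice-points s
  from inside = let q , p≡q , inBox , uncut = InDilate⇒uncut p inside
                in subst (_∈ lattice-points s) (sym p≡q)
                         (∈-map⁺ toZ (∈-filter⁺ (uncut? s) (Equivalence.from ∈-cube⇔InBox inBox) uncut))

lattice-count : ∀ {s} → 1 ≤ s → LatticeCount s (uncut-count s)
lattice-count {s} 1≤s = lattice-points s , lattice-points-unique s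
  , trans (length-map toZ (filter (uncut? s) (cube (suc s)))) (count-cube (uncut? s) (suc s))
  , ∈-lattice-points⇔InDilate 1≤s

6*uncut-count : ∀ s → 6 * uncut-count s + 8 * (⌈ s /2⌉ * suc ⌈ s /2⌉ * suc (suc ⌈ s /2⌉))
                      ≡ 6 * (suc s * (suc s * (suc s * 1)))
6*uncut-count s = begin
  6 * uncut-count s + 8 * (h * suc h * suc (suc h)) ≡⟨ cong (λ t → 6 * uncut-count s + 8 * t) (6*tetrahedral h) ⟨
  6 * uncut-count s + 8 * (6 * tetrahedral h)       ≡⟨ regroup (uncut-count s) (tetrahedral h) ⟩
  6 * (uncut-count s + 8 * tetrahedral h)           ≡⟨ cong (6 *_) (uncut+corners≡cube s) ⟩
  6 * (suc s * (suc s * (suc s * 1)))               ∎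
  where
  h = ⌈ s /2⌉
  regroup : ∀ c t → 6 * c + 8 * (6 * t) ≡ 6 * (c + 8 * t)
  regroup = solve-∀

⌈2m/2⌉≡m : ∀ m → ⌈ 2 * m /2⌉ ≡ m
⌈2m/2⌉≡m 0       = refl
⌈2m/2⌉≡m (suc m) = trans (cong ⌈_/2⌉ (*-suc 2 m)) (cong suc (⌈2m/2⌉≡m m))

⌈1+2m/2⌉≡1+m : ∀ m → ⌈ 1 + 2 * m /2⌉ ≡ suc m
⌈1+2m/2⌉≡1+m 0       = refl
⌈1+2m/2⌉≡1+m (suc m) = trans (cong (⌈_/2⌉ ∘ suc) (*-suc 2 m)) (cong suc (⌈1+2m/2⌉≡1+m m))

even-count : ∀ m → let s = 2 * m in 6 * uncut-count s ≡ 5 * s ^ 3 + 12 * s ^ 2 + 10 * s + 6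
even-count m = +-cancelʳ-≡ (8 * (m * suc m * suc (suc m))) _ _ (begin
  6 * uncut-count s + 8 * (m * suc m * suc (suc m))
    ≡⟨ cong (λ h → 6 * uncut-count s + 8 * (h * suc h * suc (suc h))) (⌈2m/2⌉≡m m) ⟨
  6 * uncut-count s + 8 * (⌈ s /2⌉ * suc ⌈ s /2⌉ * suc (suc ⌈ s /2⌉))
    ≡⟨ 6*uncut-count s ⟩
  6 * (suc s * (suc s * (suc s * 1)))
    ≡⟨ identity m ⟩
  5 * s ^ 3 + 12 * s ^ 2 + 10 * s + 6 + 8 * (m * suc m * suc (suc m)) ∎)
  where
  s = 2 * m
  identity : ∀ m → let s = 2 * m in
    6 * (suc s * (suc s * (suc s * 1)))
      ≡ 5 * (s * (s * (s * 1))) + 12 * (s * (s * 1)) + 10 * s + 6 + 8 * (m * suc m * suc (suc m))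
  identity = solve-∀

odd-count : ∀ m → let s = 1 + 2 * m in 6 * uncut-count s + 5 * s + 9 ≡ 5 * s ^ 3 + 9 * s ^ 2
odd-count m = +-cancelʳ-≡ (8 * (suc m * suc (suc m) * suc (suc (suc m)))) _ _ (begin
  6 * uncut-count s + 5 * s + 9 + 8 * (suc m * suc (suc m) * suc (suc (suc m)))
    ≡⟨ cong (λ h → 6 * uncut-count s + 5 * s + 9 + 8 * (h * suc h * suc (suc h))) (⌈1+2m/2⌉≡1+m m) ⟨
  6 * uncut-count s + 5 * s + 9 + 8 * H
    ≡⟨ regroup (6 * uncut-count s) (8 * H) (5 * s) 9 ⟩
  6 * uncut-count s + 8 * H + (5 * s + 9)
    ≡⟨ cong (_+ (5 * s + 9)) (6*uncut-count s) ⟩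
  6 * (suc s * (suc s * (suc s * 1))) + (5 * s + 9)
    ≡⟨ identity m ⟩
  5 * s ^ 3 + 9 * s ^ 2 + 8 * (suc m * suc (suc m) * suc (suc (suc m))) ∎)
  where
  s = 1 + 2 * m
  H = ⌈ s /2⌉ * suc ⌈ s /2⌉ * suc (suc ⌈ s /2⌉)
  regroup : ∀ a b c d → a + c + d + b ≡ a + b + (c + d)
  regroup = solve-∀
  identity : ∀ m → let s = 1 + 2 * m in
    6 * (suc s * (suc s * (suc s * 1))) + (5 * s + 9)
      ≡ 5 * (s * (s * (s * 1))) + 9 * (s * (s * 1)) + 8 * (suc m * suc (suc m) * suc (suc (suc m)))
  identity = solve-∀

mainTheorem10 : (s : ℕ) → 1 ≤ s →
    ∃[ n ] ( LatticeCount s n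
    × (s % 2 ≡ 0 → 6 * n ≡ 5 * s ^ 3 + 12 * s ^ 2 + 10 * s + 6)
    × (s % 2 ≡ 1 → 6 * n + 5 * s + 9 ≡ 5 * s ^ 3 + 9 * s ^ 2) )
mainTheorem10 s 1≤s = uncut-count s , lattice-count 1≤s , even , odd
  where
  s≡s%2+2[s/2] : s ≡ s % 2 + 2 * (s / 2)
  s≡s%2+2[s/2] = trans (m≡m%n+[m/n]*n s 2) (cong (λ t → s % 2 + t) (*-comm (s / 2) 2))
  even : s % 2 ≡ 0 → 6 * uncut-count s ≡ 5 * s ^ 3 + 12 * s ^ 2 + 10 * s + 6
  even s%2≡0 = subst (λ s → 6 * uncut-count s ≡ 5 * s ^ 3 + 12 * s ^ 2 + 10 * s + 6)
                     (sym (trans s≡s%2+2[s/2] (cong (_+ 2 * (s / 2)) s%2≡0))) (even-count (s / 2))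
  odd : s % 2 ≡ 1 → 6 * uncut-count s + 5 * s + 9 ≡ 5 * s ^ 3 + 9 * s ^ 2
  odd s%2≡1 = subst (λ s → 6 * uncut-count s + 5 * s + 9 ≡ 5 * s ^ 3 + 9 * s ^ 2)
                    (sym (trans s≡s%2+2[s/2] (cong (_+ 2 * (s / 2)) s%2≡1))) (odd-count (s / 2))
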